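{- Let $k\ge1$ and let $\lambda,\mu$ be partitions; for $n\ge\max(\ell(\lambda),\ell(\mu))$ let $\operatorname{Pet}^{(n)}_k(\lambda,\mu)$ be the $n\times n$ matrix with $(i,j)$ entry $1$ if $0\le\lambda_i-i-\mu_j+j<k$ and $0$ otherwise, and $\operatorname{pet}^{(n)}_k(\lambda,\mu)$ its determinant. Then: (1) If $\mu\not\subseteq\lambda$, or $\lambda_i\ge\mu_i+k$ for some $i$, then $\operatorname{pet}^{(n)}_k(\lambda,\mu)=0$. (2) If $1\le p<n$ and $\lambda_{p+1}\le\mu_p$ (so that $\lambda/\mu$ decomposes into the two mutually disconnected skew shapes formed by rows $1,\dots,p$ and rows $p+1,\dots,n$), then $\operatorname{pet}^{(n)}_k(\lambda,\mu)=\operatorname{pet}^{(p)}_k(\lambda^1,\mu^1)\cdot\operatorname{pet}^{(n-p)}_k(\lambda^2,\mu^2)$, where $\lambda^1=(\lambda_1,\dots,\lambda_p)$, $\mu^1=(\mu_1,\dots,\mu_p)$, $\lambda^2=(\lambda_{p+1},\dots,\lambda_n)$, $\mu^2=(\mu_{p+1},\dots,\mu_n)$. (3) $\operatorname{pet}^{(n+1)}_k(\lambda,\mu)=\operatorname{pet}^{(n)}_k(\lambda,\mu)$; i.e. appending trailing zeros does not change the value.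
   Context: Partitions are weakly decreasing sequences of nonnegative integers with finitely many nonzero terms, with $\lambda_i=0$ for $i>\ell(\lambda)$. $\mu\subseteq\lambda$ means $\mu_i\le\lambda_i$ for all $i$. -}

module Defs where

open import Data.Nat using (ℕ; zero; suc; _≤_; _≥_; _⊔_)
open import Data.Integer as ℤ using (ℤ; +_; -_; 0ℤ; 1ℤ)
open import Data.Fin using (Fin; zero; suc; toℕ; punchIn)
open import Data.List using (List; []; _∷_; length)
open import Data.List.Relation.Unary.All using (All)
open import Data.List.Relation.Unary.Linked using (Linked)
open import Relation.Nullary using (does)
open import Data.Bool using (Bool; true; false; _∧_; if_then_else_)

-- A partition, represented by its list of nonzero parts
-- (λ₁ ≥ λ₂ ≥ … ≥ λ_ℓ ≥ 1); all further parts are 0.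
record Partition : Set where
  field
    parts      : List ℕ
    positive   : All (λ x → 1 ≤ x) parts
    decreasing : Linked _≥_ parts
open Partition public

len : Partition → ℕ
len λ' = length (parts λ')

-- i-th entry of a sequence given by a list, 0-indexed, padded with zeros:
-- xs ! i = x_{i+1}.
_!_ : List ℕ → ℕ → ℕ
[]       ! _     = 0
(x ∷ xs) ! zero  = x
(x ∷ xs) ! suc i = xs ! i

part : Partition → ℕ → ℕ
part λ' i = parts λ' ! i

_⊆ᵖ_ : Partition → Partition → Set
μ ⊆ᵖ λ' = ∀ i → part μ i ≤ part λ' i

Σᶠ : ∀ {n} → (Fin n → ℤ) → ℤ
Σᶠ {zero}  f = 0ℤ
Σᶠ {suc n} f = f zero ℤ.+ Σᶠ (λ j → f (suc j))

sgn : ℕ → ℤ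
sgn zero    = 1ℤ
sgn (suc m) = - sgn m

det : ∀ {n} → (Fin n → Fin n → ℤ) → ℤ
det {zero}  A = 1ℤ
det {suc n} A =
  Σᶠ (λ j → sgn (toℕ j) ℤ.* (A zero j ℤ.* det (λ r c → A (suc r) (punchIn j c))))

petEntry : ℕ → ℕ → ℕ → ℕ → ℕ → ℤ
petEntry k a i b j =
  let d = (((+ a) ℤ.- (+ i)) ℤ.- (+ b)) ℤ.+ (+ j) in
  if does (0ℤ ℤ.≤? d) ∧ does (d ℤ.<? (+ k)) then 1ℤ else 0ℤ

-- Row/column indices are 0-based here (i = row i+1); since only the
-- difference j - i enters, the entry equals the paper's
-- [0 ≤ λ_{i+1} - (i+1) - μ_{j+1} + (j+1) < k].
Pet : ℕ → (n : ℕ) → List ℕ → List ℕ → Fin n → Fin n → ℤ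
Pet k n α β i j = petEntry k (α ! toℕ i) (toℕ i) (β ! toℕ j) (toℕ j)

pet : ℕ → ℕ → List ℕ → List ℕ → ℤ
pet k n α β = det (Pet k n α β)

{-# OPTIONS --safe #-}
-- The (i, j) entry of Pet is nonzero only if μ_j - j ≤ λ_i - i < μ_j - j + k, and both
-- λ_i - i and μ_j - j are strictly decreasing.  So λ_i < μ_i forces zeros in rows ≥ i and
-- columns ≤ i, and λ_i ≥ μ_i + k forces zeros in rows ≤ i and columns ≥ i; either zero block
-- has n + 1 rows plus columns, so the determinant vanishes.  Likewise λ_{p+1} ≤ μ_p forces
-- zeros in rows > p and columns ≤ p, making Pet block triangular, and a trailing zero part
-- adds a last row that vanishes except for its diagonal entry 1.
module Submission where

open import Defs
open import Data.Nat using (ℕ; _≤_; _<_; _+_; _∸_; _⊔_)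
open import Data.Integer using (ℤ; 0ℤ; _*_)
open import Data.List using (take; drop)
open import Data.Product using (_×_; ∃-syntax)
open import Data.Sum using (_⊎_)
open import Relation.Nullary using (¬_)
open import Relation.Binary.PropositionalEquality using (_≡_)

open import Algebra.Properties.CommutativeSemigroup using (xy∙z≈xz∙y)
open import Data.Bool using (_∧_; if_then_else_)
open import Data.Fin using (Fin; toℕ; punchIn)
import Data.Fin as Fin
open import Data.Fin.Properties using (toℕ<n)
open import Data.Integer.Base as ℤ using (1ℤ; +_; _⊖_)
import Data.Integer.Properties as ℤ
open import Data.Integer.Tactic.RingSolver using (solve-∀)
open import Data.List using (List; []; _∷_; length)
open import Data.List.Relation.Unary.Linked using (Linked; []; [-]; _∷_)
open import Data.Nat using (zero; suc; z≤n; s≤s; _≥_; _≤?_; _<?_)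
open import Data.Nat.Properties
  using ( ≤-refl; ≤-reflexive; ≤-trans; <-≤-trans; ≤-<-trans; <⇒≤; ≰⇒>; ≮⇒≥
        ; +-identityʳ; m≤m+n; m≤n+m; +-monoˡ-≤; +-mono-≤; +-mono-<-≤; +-mono-≤-<
        ; m+n∸m≡n; m+[n∸m]≡n; m<n⇒0<n∸m; m⊔n≤o⇒m≤o; m⊔n≤o⇒n≤o
        ; anyUpTo?; +-commutativeSemigroup; module ≤-Reasoning)
open import Data.Product using (_,_)
open import Data.Sum using ([_,_]′)
open import Function using (_∘_)
open import Relation.Nullary using (yes; no; does; contradiction)
open import Relation.Binary.PropositionalEquality
  using (refl; sym; trans; cong; cong₂; subst; module ≡-Reasoning)

∑< : ℕ → (ℕ → ℤ) → ℤ
∑< zero    f = 0ℤ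
∑< (suc n) f = f 0 ℤ.+ ∑< n (f ∘ suc)

syntax ∑< n (λ j → e) = ∑[ j < n ] e

Σᶠ-toℕ : ∀ n (f : ℕ → ℤ) → Σᶠ {n} (f ∘ toℕ) ≡ ∑< n f
Σᶠ-toℕ zero    f = refl
Σᶠ-toℕ (suc n) f = cong (ℤ._+_ (f 0)) (Σᶠ-toℕ n (f ∘ suc))

Σᶠ-cong : ∀ {n} {f g : Fin n → ℤ} → (∀ j → f j ≡ g j) → Σᶠ f ≡ Σᶠ g
Σᶠ-cong {zero}  f≗g = refl
Σᶠ-cong {suc n} f≗g = cong₂ ℤ._+_ (f≗g Fin.zero) (Σᶠ-cong (f≗g ∘ Fin.suc))

∑<-cong : ∀ n {f g : ℕ → ℤ} → (∀ j → j < n → f j ≡ g j) → ∑< n f ≡ ∑< n g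
∑<-cong zero    f≗g = refl
∑<-cong (suc n) f≗g =
  cong₂ ℤ._+_ (f≗g 0 (s≤s z≤n)) (∑<-cong n (λ j j<n → f≗g (suc j) (s≤s j<n)))

∑<-zero : ∀ n {f : ℕ → ℤ} → (∀ j → j < n → f j ≡ 0ℤ) → ∑< n f ≡ 0ℤ
∑<-zero zero    f≗0 = refl
∑<-zero (suc n) f≗0 =
  cong₂ ℤ._+_ (f≗0 0 (s≤s z≤n)) (∑<-zero n (λ j j<n → f≗0 (suc j) (s≤s j<n)))

∑<-+ : ∀ m n (f : ℕ → ℤ) → ∑< (m + n) f ≡ ∑< m f ℤ.+ ∑[ j < n ] f (m + j)
∑<-+ zero    n f = sym (ℤ.+-identityˡ _)
∑<-+ (suc m) n f = trans (cong (ℤ._+_ (f 0)) (∑<-+ m n (f ∘ suc))) (sym (ℤ.+-assoc (f 0) _ _))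

∑<-*ʳ : ∀ n (f : ℕ → ℤ) x → ∑[ j < n ] (f j * x) ≡ ∑< n f * x
∑<-*ʳ zero    f x = sym (ℤ.*-zeroˡ x)
∑<-*ʳ (suc n) f x =
  trans (cong (ℤ._+_ (f 0 * x)) (∑<-*ʳ n (f ∘ suc) x)) (sym (ℤ.*-distribʳ-+ x (f 0) _))

det-cong : ∀ {n} {A B : Fin n → Fin n → ℤ} → (∀ i j → A i j ≡ B i j) → det A ≡ det B
det-cong {zero}  A≗B = refl
det-cong {suc n} A≗B = Σᶠ-cong λ j → cong (sgn (toℕ j) *_)
  (cong₂ _*_ (A≗B Fin.zero j) (det-cong (λ r c → A≗B (Fin.suc r) (punchIn j c))))

-- Matrices are indexed by ℕ so that blocks are reached by shifting indices;
-- detₙ n only reads the leading n × n corner.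
Matrix : Set
Matrix = ℕ → ℕ → ℤ

detₙ : ℕ → Matrix → ℤ
detₙ n M = det {n} (λ i j → M (toℕ i) (toℕ j))

detₙ-cong : ∀ n {M N : Matrix} → (∀ r c → r < n → c < n → M r c ≡ N r c) → detₙ n M ≡ detₙ n N
detₙ-cong n M≗N = det-cong (λ i j → M≗N (toℕ i) (toℕ j) (toℕ<n i) (toℕ<n j))

detₙ-one : ∀ M → detₙ 1 M ≡ M 0 0
detₙ-one M = trans (ℤ.+-identityʳ _) (trans (ℤ.*-identityˡ _) (ℤ.*-identityʳ (M 0 0)))

shift : ℕ → Matrix → Matrix
shift p M r c = M (p + r) (p + c)

punchInℕ : ℕ → ℕ → ℕ
punchInℕ zero    c       = suc c
punchInℕ (suc j) zero    = zero
punchInℕ (suc j) (suc c) = suc (punchInℕ j c)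

toℕ-punchIn : ∀ {n} (j : Fin (suc n)) (c : Fin n) → toℕ (punchIn j c) ≡ punchInℕ (toℕ j) (toℕ c)
toℕ-punchIn Fin.zero    c           = refl
toℕ-punchIn (Fin.suc j) Fin.zero    = refl
toℕ-punchIn (Fin.suc j) (Fin.suc c) = cong suc (toℕ-punchIn j c)

punchInℕ-< : ∀ {j c} → c < j → punchInℕ j c ≡ c
punchInℕ-< {suc j} {zero}  _         = refl
punchInℕ-< {suc j} {suc c} (s≤s c<j) = cong suc (punchInℕ-< c<j)

punchInℕ-≥ : ∀ {j c} → j ≤ c → punchInℕ j c ≡ suc c
punchInℕ-≥ {zero}          _         = refl
punchInℕ-≥ {suc j} {suc c} (s≤s j≤c) = cong suc (punchInℕ-≥ j≤c)

punchInℕ-≤ : ∀ j c → punchInℕ j c ≤ suc c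
punchInℕ-≤ zero    c       = ≤-refl
punchInℕ-≤ (suc j) zero    = z≤n
punchInℕ-≤ (suc j) (suc c) = s≤s (punchInℕ-≤ j c)

minor : ℕ → Matrix → Matrix
minor j M r c = M (suc r) (punchInℕ j c)

laplaceTerm : ℕ → Matrix → ℕ → ℤ
laplaceTerm n M j = sgn j * (M 0 j * detₙ n (minor j M))

detₙ-expand : ∀ n M → detₙ (suc n) M ≡ ∑< (suc n) (laplaceTerm n M)
detₙ-expand n M = trans
  (Σᶠ-cong {suc n} λ j → cong (λ d → sgn (toℕ j) * (M 0 (toℕ j) * d))
    (det-cong {n} (λ r c → cong (M (suc (toℕ r))) (toℕ-punchIn j c))))
  (Σᶠ-toℕ (suc n) (laplaceTerm n M))

laplaceTerm-zero-entry : ∀ n M j → M 0 j ≡ 0ℤ → laplaceTerm n M j ≡ 0ℤ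
laplaceTerm-zero-entry n M j M₀ⱼ≡0 = begin
  sgn j * (M 0 j * detₙ n (minor j M)) ≡⟨ cong (λ m → sgn j * (m * detₙ n (minor j M))) M₀ⱼ≡0 ⟩
  sgn j * (0ℤ * detₙ n (minor j M))    ≡⟨ ℤ.*-zeroʳ (sgn j) ⟩
  0ℤ                                   ∎
  where open ≡-Reasoning

laplaceTerm-zero-minor : ∀ n M j → detₙ n (minor j M) ≡ 0ℤ → laplaceTerm n M j ≡ 0ℤ
laplaceTerm-zero-minor n M j minor≡0 = begin
  sgn j * (M 0 j * detₙ n (minor j M)) ≡⟨ cong (λ d → sgn j * (M 0 j * d)) minor≡0 ⟩
  sgn j * (M 0 j * 0ℤ)                 ≡⟨ cong (sgn j *_) (ℤ.*-zeroʳ (M 0 j)) ⟩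
  sgn j * 0ℤ                           ≡⟨ ℤ.*-zeroʳ (sgn j) ⟩
  0ℤ                                   ∎
  where open ≡-Reasoning

detₙ-zero-column₀ : ∀ {n} M → 0 < n → (∀ r → M r 0 ≡ 0ℤ) → detₙ n M ≡ 0ℤ
detₙ-zero-column₀ {suc n} M _ column≡0 = trans (detₙ-expand n M) (∑<-zero (suc n) vanish)
  where
  vanish : ∀ j → j < suc n → laplaceTerm n M j ≡ 0ℤ
  vanish zero    _         = laplaceTerm-zero-entry n M 0 (column≡0 0)
  vanish (suc j) (s≤s j<n) = laplaceTerm-zero-minor n M (suc j)
    (detₙ-zero-column₀ (minor (suc j) M) (≤-<-trans z≤n j<n) (column≡0 ∘ suc))

detₙ-zero-upperRight : ∀ {n p} M → p < n → (∀ r c → r ≤ p → p ≤ c → M r c ≡ 0ℤ) →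
                       detₙ n M ≡ 0ℤ
detₙ-zero-upperRight {suc n} {zero} M _ block≡0 = trans (detₙ-expand n M)
  (∑<-zero (suc n) (λ j _ → laplaceTerm-zero-entry n M j (block≡0 0 j z≤n z≤n)))
detₙ-zero-upperRight {suc n} {suc p} M (s≤s p<n) block≡0 =
  trans (detₙ-expand n M) (∑<-zero (suc n) vanish)
  where
  vanish : ∀ j → j < suc n → laplaceTerm n M j ≡ 0ℤ
  vanish j _ with j ≤? p
  ... | no  j≰p = laplaceTerm-zero-entry n M j (block≡0 0 j z≤n (≰⇒> j≰p))
  ... | yes j≤p = laplaceTerm-zero-minor n M j (detₙ-zero-upperRight (minor j M) p<n
          λ r c r≤p p≤c → trans (cong (M (suc r)) (punchInℕ-≥ (≤-trans j≤p p≤c)))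
                                (block≡0 (suc r) (suc c) (s≤s r≤p) (s≤s p≤c)))

detₙ-blockTriangular : ∀ p q M → (∀ r c → p ≤ r → c < p → M r c ≡ 0ℤ) →
                       detₙ (p + q) M ≡ detₙ p M * detₙ q (shift p M)
detₙ-blockTriangular zero    q M _        = sym (ℤ.*-identityˡ _)
detₙ-blockTriangular (suc p) q M block≡0 = begin
    detₙ (suc p + q) M
  ≡⟨ detₙ-expand (p + q) M ⟩
    ∑< (suc p + q) (laplaceTerm (p + q) M)
  ≡⟨ ∑<-+ (suc p) q (laplaceTerm (p + q) M) ⟩
    ∑< (suc p) (laplaceTerm (p + q) M) ℤ.+ ∑[ t < q ] laplaceTerm (p + q) M (suc p + t)
  ≡⟨ cong₂ ℤ._+_ (∑<-cong (suc p) leading) (∑<-zero q trailing) ⟩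
    ∑[ j < suc p ] (laplaceTerm p M j * R) ℤ.+ 0ℤ
  ≡⟨ ℤ.+-identityʳ _ ⟩
    ∑[ j < suc p ] (laplaceTerm p M j * R)
  ≡⟨ ∑<-*ʳ (suc p) (laplaceTerm p M) R ⟩
    ∑< (suc p) (laplaceTerm p M) * R
  ≡⟨ cong (_* R) (sym (detₙ-expand p M)) ⟩
    detₙ (suc p) M * R
  ∎
  where
  open ≡-Reasoning

  R : ℤ
  R = detₙ q (shift (suc p) M)

  minor-factorises : ∀ j → detₙ (p + q) (minor j M)
                         ≡ detₙ p (minor j M) * detₙ q (shift p (minor j M))
  minor-factorises j = detₙ-blockTriangular p q (minor j M) λ r c p≤r c<p →
    block≡0 (suc r) (punchInℕ j c) (s≤s p≤r) (≤-<-trans (punchInℕ-≤ j c) (s≤s c<p))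

  leading : ∀ j → j < suc p → laplaceTerm (p + q) M j ≡ laplaceTerm p M j * R
  leading j (s≤s j≤p) = begin
      sgn j * (M 0 j * detₙ (p + q) (minor j M))
    ≡⟨ cong (λ d → sgn j * (M 0 j * d)) (minor-factorises j) ⟩
      sgn j * (M 0 j * (detₙ p (minor j M) * detₙ q (shift p (minor j M))))
    ≡⟨ cong (λ d → sgn j * (M 0 j * (detₙ p (minor j M) * d))) (detₙ-cong q λ r c _ _ →
         cong (M (suc (p + r))) (punchInℕ-≥ (≤-trans j≤p (m≤m+n p c)))) ⟩
      sgn j * (M 0 j * (detₙ p (minor j M) * R))
    ≡⟨ cong (sgn j *_) (sym (ℤ.*-assoc (M 0 j) _ R)) ⟩
      sgn j * (M 0 j * detₙ p (minor j M) * R)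
    ≡⟨ sym (ℤ.*-assoc (sgn j) _ R) ⟩
      laplaceTerm p M j * R
    ∎

  -- Deleting a column j > p keeps column p of M, which vanishes below row p; so the
  -- lower right block of the minor has a zero first column.
  trailing : ∀ t → t < q → laplaceTerm (p + q) M (suc p + t) ≡ 0ℤ
  trailing t t<q = laplaceTerm-zero-minor (p + q) M j (begin
      detₙ (p + q) (minor j M)
    ≡⟨ minor-factorises j ⟩
      detₙ p (minor j M) * detₙ q (shift p (minor j M))
    ≡⟨ cong (detₙ p (minor j M) *_)
            (detₙ-zero-column₀ (shift p (minor j M)) (≤-<-trans z≤n t<q) column₀≡0) ⟩
      detₙ p (minor j M) * 0ℤ
    ≡⟨ ℤ.*-zeroʳ (detₙ p (minor j M)) ⟩
      0ℤ
    ∎)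
    where
    j : ℕ
    j = suc p + t

    p+0≤p : p + 0 ≤ p
    p+0≤p = ≤-reflexive (+-identityʳ p)

    column₀≡0 : ∀ r → shift p (minor j M) r 0 ≡ 0ℤ
    column₀≡0 r = trans (cong (M (suc (p + r))) (punchInℕ-< (s≤s (≤-trans p+0≤p (m≤m+n p t)))))
                        (block≡0 (suc (p + r)) (p + 0) (s≤s (m≤m+n p r)) (s≤s p+0≤p))

detₙ-zero-lowerLeft : ∀ {n p} M → p < n → (∀ r c → p ≤ r → c ≤ p → M r c ≡ 0ℤ) →
                      detₙ n M ≡ 0ℤ
detₙ-zero-lowerLeft {n} {p} M p<n block≡0 = begin
    detₙ n M
  ≡⟨ cong (λ m → detₙ m M) (sym (m+[n∸m]≡n (<⇒≤ p<n))) ⟩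
    detₙ (p + (n ∸ p)) M
  ≡⟨ detₙ-blockTriangular p (n ∸ p) M (λ r c p≤r c<p → block≡0 r c p≤r (<⇒≤ c<p)) ⟩
    detₙ p M * detₙ (n ∸ p) (shift p M)
  ≡⟨ cong (detₙ p M *_) (detₙ-zero-column₀ (shift p M) (m<n⇒0<n∸m p<n) λ r →
       block≡0 (p + r) (p + 0) (m≤m+n p r) (≤-reflexive (+-identityʳ p))) ⟩
    detₙ p M * 0ℤ
  ≡⟨ ℤ.*-zeroʳ (detₙ p M) ⟩
    0ℤ
  ∎
  where open ≡-Reasoning

band : ℕ → ℤ → ℤ
band k d = if does (0ℤ ℤ.≤? d) ∧ does (d ℤ.<? + k) then 1ℤ else 0ℤ

band-<0 : ∀ k {d} → d ℤ.< 0ℤ → band k d ≡ 0ℤ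
band-<0 k {d} d<0 with 0ℤ ℤ.≤? d
... | yes 0≤d = contradiction d<0 (ℤ.≤⇒≯ 0≤d)
... | no  _   = refl

band-≥ : ∀ k {d} → + k ℤ.≤ d → band k d ≡ 0ℤ
band-≥ k {d} k≤d with 0ℤ ℤ.≤? d | d ℤ.<? + k
... | _     | yes d<k = contradiction d<k (ℤ.≤⇒≯ k≤d)
... | yes _ | no  _   = refl
... | no  _ | no  _   = refl

petEntry≡band : ∀ k a i b j → petEntry k a i b j ≡ band k ((a + j) ⊖ (b + i))
petEntry≡band k a i b j =
  cong (band k) (trans (offset (+ a) (+ i) (+ b) (+ j)) (ℤ.m-n≡m⊖n (a + j) (b + i)))
  where
  offset : ∀ (a i b j : ℤ) → a ℤ.- i ℤ.- b ℤ.+ j ≡ (a ℤ.+ j) ℤ.- (b ℤ.+ i)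
  offset = solve-∀

petEntry-below : ∀ k a i b j → a + j < b + i → petEntry k a i b j ≡ 0ℤ
petEntry-below k a i b j lt = trans (petEntry≡band k a i b j)
  (band-<0 k (subst ((a + j) ⊖ (b + i) ℤ.<_) (ℤ.n⊖n≡0 (b + i)) (ℤ.⊖-monoˡ-< (b + i) lt)))

petEntry-above : ∀ k a i b j → b + i + k ≤ a + j → petEntry k a i b j ≡ 0ℤ
petEntry-above k a i b j le = trans (petEntry≡band k a i b j)
  (band-≥ k (subst (ℤ._≤ (a + j) ⊖ (b + i)) k≡ (ℤ.⊖-monoˡ-≤ (b + i) le)))
  where
  k≡ : (b + i + k) ⊖ (b + i) ≡ + k
  k≡ = trans (ℤ.⊖-≥ (m≤m+n (b + i) k)) (cong +_ (m+n∸m≡n (b + i) k))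

petEntry-diagonal : ∀ {k} → 1 ≤ k → ∀ a i b j → a + j ≡ b + i → petEntry k a i b j ≡ 1ℤ
petEntry-diagonal {suc k} _ a i b j eq = trans (petEntry≡band (suc k) a i b j)
  (cong (band (suc k)) (trans (cong (_⊖ (b + i)) eq) (ℤ.n⊖n≡0 (b + i))))

petEntry-shift : ∀ k a p i b j → petEntry k a (p + i) b (p + j) ≡ petEntry k a i b j
petEntry-shift k a p i b j = cong (band k) (offset (+ a) (+ p) (+ i) (+ b) (+ j))
  where
  offset : ∀ (a p i b j : ℤ) → a ℤ.- (p ℤ.+ i) ℤ.- b ℤ.+ (p ℤ.+ j) ≡ a ℤ.- i ℤ.- b ℤ.+ j
  offset = solve-∀

-- pet k n α β is definitionally detₙ n (petMatrix k α β).
petMatrix : ℕ → List ℕ → List ℕ → Matrix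
petMatrix k α β r c = petEntry k (α ! r) r (β ! c) c

!-≥length : ∀ (xs : List ℕ) {i} → length xs ≤ i → xs ! i ≡ 0
!-≥length []       _         = refl
!-≥length (x ∷ xs) (s≤s len≤i) = !-≥length xs len≤i

!-positive⇒<length : ∀ (xs : List ℕ) i → 0 < xs ! i → i < length xs
!-positive⇒<length (x ∷ xs) zero    _   = s≤s z≤n
!-positive⇒<length (x ∷ xs) (suc i) pos = s≤s (!-positive⇒<length xs i pos)

!-take : ∀ p (xs : List ℕ) {i} → i < p → take p xs ! i ≡ xs ! i
!-take (suc p) []       _         = refl
!-take (suc p) (x ∷ xs) {zero}  _ = refl
!-take (suc p) (x ∷ xs) {suc i} (s≤s i<p) = !-take p xs i<p

!-drop : ∀ p (xs : List ℕ) i → drop p xs ! i ≡ xs ! (p + i)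
!-drop zero    xs       i = refl
!-drop (suc p) []       i = refl
!-drop (suc p) (x ∷ xs) i = !-drop p xs i

!-antitone : ∀ {xs : List ℕ} → Linked _≥_ xs → ∀ {i j} → i ≤ j → xs ! j ≤ xs ! i
!-antitone []        _                 = z≤n
!-antitone [-]       {j = zero}  z≤n  = ≤-refl
!-antitone [-]       {j = suc j} _    = z≤n
!-antitone (x≥y ∷ l) {j = zero}  z≤n  = ≤-refl
!-antitone (x≥y ∷ l) {j = suc j} z≤n  = ≤-trans (!-antitone l {j = j} z≤n) x≥y
!-antitone (x≥y ∷ l) (s≤s i≤j)       = !-antitone l i≤j

part-antitone : ∀ (λ' : Partition) {i j} → i ≤ j → part λ' j ≤ part λ' i
part-antitone λ' = !-antitone (decreasing λ')

⊈⇒∃< : ∀ (λ' μ : Partition) → ¬ (μ ⊆ᵖ λ') → ∃[ i ] part λ' i < part μ i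
⊈⇒∃< λ' μ μ⊈λ with anyUpTo? (λ i → part λ' i <? part μ i) (len μ)
... | yes (i , _ , λᵢ<μᵢ) = i , λᵢ<μᵢ
... | no  ∄i = contradiction (λ i → ≮⇒≥ (λ λᵢ<μᵢ →
        ∄i (i , !-positive⇒<length (parts μ) i (≤-<-trans z≤n λᵢ<μᵢ) , λᵢ<μᵢ))) μ⊈λ

pet≡0-if-⊈ : ∀ k (λ' μ : Partition) {n} → len μ ≤ n → ¬ (μ ⊆ᵖ λ') →
             pet k n (parts λ') (parts μ) ≡ 0ℤ
pet≡0-if-⊈ k λ' μ μ≤n μ⊈λ with ⊈⇒∃< λ' μ μ⊈λ
... | i , λᵢ<μᵢ = detₙ-zero-lowerLeft (petMatrix k (parts λ') (parts μ))
  (<-≤-trans (!-positive⇒<length (parts μ) i (≤-<-trans z≤n λᵢ<μᵢ)) μ≤n)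
  λ r c i≤r c≤i → petEntry-below k (part λ' r) r (part μ c) c (+-mono-<-≤
    (≤-<-trans (part-antitone λ' i≤r) (<-≤-trans λᵢ<μᵢ (part-antitone μ c≤i)))
    (≤-trans c≤i i≤r))

pet≡0-if-longRow : ∀ {k} → 1 ≤ k → ∀ (λ' μ : Partition) {n i} → len λ' ≤ n →
                   part μ i + k ≤ part λ' i → pet k n (parts λ') (parts μ) ≡ 0ℤ
pet≡0-if-longRow {k} 1≤k λ' μ {n} {i} λ≤n long = detₙ-zero-upperRight
  (petMatrix k (parts λ') (parts μ))
  (<-≤-trans (!-positive⇒<length (parts λ') i (≤-trans 1≤k (≤-trans (m≤n+m k _) long)))
             λ≤n)
  λ r c r≤i i≤c → petEntry-above k (part λ' r) r (part μ c) c (begin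
      part μ c + r + k   ≡⟨ xy∙z≈xz∙y +-commutativeSemigroup (part μ c) r k ⟩
      part μ c + k + r   ≤⟨ +-monoˡ-≤ r (+-monoˡ-≤ k (part-antitone μ i≤c)) ⟩
      part μ i + k + r   ≤⟨ +-mono-≤ long (≤-trans r≤i i≤c) ⟩
      part λ' i + c      ≤⟨ +-monoˡ-≤ c (part-antitone λ' r≤i) ⟩
      part λ' r + c      ∎)
  where open ≤-Reasoning

pet-blockDiagonal : ∀ k (λ' μ : Partition) {n p} → suc p ≤ n → part λ' (suc p) ≤ part μ p →
  pet k n (parts λ') (parts μ)
    ≡ pet k (suc p) (take (suc p) (parts λ')) (take (suc p) (parts μ))
      * pet k (n ∸ suc p) (drop (suc p) (parts λ')) (drop (suc p) (parts μ))
pet-blockDiagonal k λ' μ {n} {p} p<n gap = begin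
    detₙ n P
  ≡⟨ cong (λ m → detₙ m P) (sym (m+[n∸m]≡n p<n)) ⟩
    detₙ (suc p + q) P
  ≡⟨ detₙ-blockTriangular (suc p) q P separated ⟩
    detₙ (suc p) P * detₙ q (shift (suc p) P)
  ≡⟨ cong₂ _*_ (detₙ-cong (suc p) top) (detₙ-cong q bottom) ⟩
    pet k (suc p) (take (suc p) α) (take (suc p) β) * pet k q (drop (suc p) α) (drop (suc p) β)
  ∎
  where
  open ≡-Reasoning

  α β : List ℕ
  α = parts λ'
  β = parts μ

  P : Matrix
  P = petMatrix k α β

  q : ℕ
  q = n ∸ suc p

  separated : ∀ r c → suc p ≤ r → c < suc p → P r c ≡ 0ℤ
  separated r c p<r (s≤s c≤p) = petEntry-below k (part λ' r) r (part μ c) c (+-mono-≤-<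
    (≤-trans (part-antitone λ' p<r) (≤-trans gap (part-antitone μ c≤p)))
    (<-≤-trans (s≤s c≤p) p<r))

  top : ∀ r c → r < suc p → c < suc p →
        P r c ≡ petMatrix k (take (suc p) α) (take (suc p) β) r c
  top r c r<p c<p =
    sym (cong₂ (λ a b → petEntry k a r b c) (!-take (suc p) α r<p) (!-take (suc p) β c<p))

  bottom : ∀ r c → r < q → c < q →
           shift (suc p) P r c ≡ petMatrix k (drop (suc p) α) (drop (suc p) β) r c
  bottom r c _ _ = trans (petEntry-shift k _ (suc p) r _ c)
    (sym (cong₂ (λ a b → petEntry k a r b c) (!-drop (suc p) α r) (!-drop (suc p) β c)))

pet-padding : ∀ {k} → 1 ≤ k → ∀ α β {n} → length α ≤ n → length β ≤ n →
              pet k (n + 1) α β ≡ pet k n α β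
pet-padding {k} 1≤k α β {n} α≤n β≤n = begin
    detₙ (n + 1) P
  ≡⟨ detₙ-blockTriangular n 1 P below ⟩
    detₙ n P * detₙ 1 (shift n P)
  ≡⟨ cong (detₙ n P *_) (trans (detₙ-one (shift n P)) corner) ⟩
    detₙ n P * 1ℤ
  ≡⟨ ℤ.*-identityʳ _ ⟩
    detₙ n P
  ∎
  where
  open ≡-Reasoning

  P : Matrix
  P = petMatrix k α β

  below : ∀ r c → n ≤ r → c < n → P r c ≡ 0ℤ
  below r c n≤r c<n = petEntry-below k (α ! r) r (β ! c) c (subst (λ a → a + c < β ! c + r)
    (sym (!-≥length α (≤-trans α≤n n≤r))) (<-≤-trans (<-≤-trans c<n n≤r) (m≤n+m r (β ! c))))

  corner : P (n + 0) (n + 0) ≡ 1ℤ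
  corner = petEntry-diagonal 1≤k (α ! (n + 0)) (n + 0) (β ! (n + 0)) (n + 0)
    (cong (_+ (n + 0)) (trans (!-≥length α (≤-trans α≤n (m≤m+n n 0)))
                              (sym (!-≥length β (≤-trans β≤n (m≤m+n n 0))))))

proposition3p5 : (k : ℕ) → 1 ≤ k → (λ' μ : Partition) →
  ((n : ℕ) → len λ' ⊔ len μ ≤ n →
      (¬ (μ ⊆ᵖ λ') ⊎ (∃[ i ] part μ i + k ≤ part λ' i)) →
      pet k n (parts λ') (parts μ) ≡ 0ℤ)
  × ((n p : ℕ) → len λ' ⊔ len μ ≤ n → 1 ≤ p → p < n →
      part λ' p ≤ part μ (p ∸ 1) →
      pet k n (parts λ') (parts μ)
        ≡ pet k p (take p (parts λ')) (take p (parts μ))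
          * pet k (n ∸ p) (drop p (parts λ')) (drop p (parts μ)))
  × ((n : ℕ) → len λ' ⊔ len μ ≤ n →
      pet k (n + 1) (parts λ') (parts μ) ≡ pet k n (parts λ') (parts μ))
proposition3p5 k 1≤k λ' μ =
    (λ n ℓ≤n → [ pet≡0-if-⊈ k λ' μ (μ≤ ℓ≤n)
               , (λ (_ , long) → pet≡0-if-longRow 1≤k λ' μ (λ≤ ℓ≤n) long) ]′)
  , (λ { n (suc p) _ (s≤s z≤n) p<n gap → pet-blockDiagonal k λ' μ (<⇒≤ p<n) gap })
  , (λ n ℓ≤n → pet-padding 1≤k (parts λ') (parts μ) (λ≤ ℓ≤n) (μ≤ ℓ≤n))
  where
  λ≤ : ∀ {n} → len λ' ⊔ len μ ≤ n → len λ' ≤ n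
  λ≤ = m⊔n≤o⇒m≤o (len λ') (len μ)

  μ≤ : ∀ {n} → len λ' ⊔ len μ ≤ n → len μ ≤ n
  μ≤ = m⊔n≤o⇒n≤o (len λ') (len μ)
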